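{- For any $\sqcup$-irreducible integer relation $R\in\mathcal{R}_n$, we have \begin{equation*} \Xi(R) = R +\sum_{j}b_j P_j,\end{equation*} with $b_j\in\mathbb{K}$ and $P_j\in\mathcal{R}_n$ satisfying $P_j\subsetneq R$ (strict inclusion as subsets of $[n]\times[n]$) for all $j$.
   Context: For $n\geq 1$, $[n]=\{1,\dots,n\}$, $\mathcal{R}_n$ is the set of reflexive relations on $[n]$ (subsets of $[n]\times[n]$ containing the diagonal), and $\mathbb{K}[\mathcal{R}]$ is the vector space spanned by all of them; $\#$ denotes the unique element of $\mathcal{R}_1$. For $R\in\mathcal{R}_n$, $Q\in\mathcal{R}_m$, $R\sqcup Q\in\mathcal{R}_{n+m}$ is the disjoint union: it contains $(i,j)$ for $(i,j)\in R$ and $(n+i,n+j)$ for $(i,j)\in Q$, and nothing else. A relation is $\sqcup$-irreducible if it is not of the form $R_1\sqcup R_2$ with $R_1,R_2$ both nonempty relations. For $r\geq1$ and a map $\alpha:[r]\to\{\sqcup,\uparrow,\downarrow,\updownarrow\}$ with $\alpha(r)\neq\sqcup$ (of size $s(\alpha)=r$), the product $R*_{\alpha}Q\in\mathcal{R}_{n+m}$ consists of the pairs of $R\sqcup Q$ together with $(n,n+i)$ when $\alpha(i)=\uparrow$, $(n+i,n)$ when $\alpha(i)=\downarrow$, and both $(n,n+i),(n+i,n)$ when $\alpha(i)=\updownarrow$, for $1\leq i\leq\min\{r,m\}$. All products are extended bilinearly to $\mathbb{K}[\mathcal{R}]$, and one sets $M(\alpha)(x,y):=x*_{\alpha}y-x\sqcup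 y$. Every $\sqcup$-irreducible relation $R$ with $|R|\geq2$ can be written uniquely as $R=\#*_{\alpha}R'$ with $s(\alpha)\geq1$. The map $\Xi$ from $\sqcup$-irreducible relations to $\mathbb{K}[\mathcal{R}]$ is defined recursively by: (1) $\Xi(\#):=\#$ and $\Xi(\#*_{\alpha}\#):=\#*_{\alpha}\#-\#\sqcup\#$; (2) if $R=\#*_{\alpha}R'$ with $R'$ $\sqcup$-irreducible, then $\Xi(R):=M(\alpha)(\#,\Xi(R'))=\#*_{\alpha}\Xi(R')-\#\sqcup\Xi(R')$; (3) otherwise $R=\#*_{\alpha}(R_1\sqcup\dots\sqcup R_q)$ with $q>1$, $R_1,\dots,R_q$ $\sqcup$-irreducible and (since $R$ is $\sqcup$-irreducible) $s(\alpha)>|R_1|+\dots+|R_{q-1}|$, and then \begin{equation*}\Xi(R):=\#*_{\alpha}\bigl(\Xi(R_1)\sqcup\dots\sqcup\Xi(R_q)\bigr)-\bigl(\#*_{\alpha}(\Xi(R_1)\sqcup\dots\sqcup\Xi(R_{q-1}))\bigr)\sqcup\Xi(R_q),\end{equation*} i.e. the action of the Moebius operator $M_{\vert\veebar\mathbf{0}_{q-1}}(\alpha,\sqcup,\dots,\sqcup)$ on $(\#,\Xi(R_1),\dots,\Xi(R_q))$. -}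

module Defs where

open import Level using (Level; _⊔_) renaming (suc to lsuc)
open import Algebra.Bundles using (CommutativeRing)
open import Data.Bool using (Bool; true; false; _∧_; _∨_; not; if_then_else_)
import Data.Bool.Properties as BoolP
open import Data.Nat using (ℕ; zero; suc; _+_; _∸_; _<?_; _≟_; _≤ᵇ_; _<ᵇ_; _≡ᵇ_)
open import Data.Fin using (Fin; toℕ; fromℕ<)
import Data.Fin.Properties as FinP
open import Data.Bool.ListAction using (and)
open import Data.List using (List; []; _∷_; _++_; map; concatMap; upTo; filter; foldr)
open import Data.Product using (Σ; _×_; _,_; proj₁; proj₂)
open import Relation.Nullary using (¬_; yes; no; does)
open import Relation.Binary.PropositionalEquality using (_≡_; refl)

record Field (c ℓ : Level) : Set (lsuc (c ⊔ ℓ)) where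
  field
    commutativeRing : CommutativeRing c ℓ
  open CommutativeRing commutativeRing public
  field
    0≉1     : ¬ (0# ≈ 1#)
    inverse : ∀ x → ¬ (x ≈ 0#) → Σ Carrier λ y → x * y ≈ 1#

-- Binary relations on [n] = Fin n (element i ∈ Fin n stands for toℕ i + 1).

Rel : ℕ → Set
Rel n = Fin n → Fin n → Bool

-- R ∈ 𝓡_n : contains the diagonal
Reflexive : ∀ {n} → Rel n → Set
Reflexive R = ∀ i → R i i ≡ true

_⊆_ : ∀ {n} → Rel n → Rel n → Set
P ⊆ R = ∀ i j → P i j ≡ true → R i j ≡ true

_≐_ : ∀ {n} → Rel n → Rel n → Set
P ≐ R = ∀ i j → P i j ≡ R i j

_⊊_ : ∀ {n} → Rel n → Rel n → Set
P ⊊ R = (P ⊆ R) × ¬ (P ≐ R)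

EqRel : ∀ {n m} → n ≡ m → Rel n → Rel m → Set
EqRel refl R Q = R ≐ Q

_≅_ : ∀ {n m} → Rel n → Rel m → Set
_≅_ {n} {m} R Q = Σ (n ≡ m) λ e → EqRel e R Q

-- relations as 0-based ℕ-indexed predicates (false out of range), and back
ext : ∀ {n} → Rel n → ℕ → ℕ → Bool
ext {n} R i j with i <? n | j <? n
... | yes p | yes q = R (fromℕ< p) (fromℕ< q)
... | _     | _     = false

tab : (n : ℕ) → (ℕ → ℕ → Bool) → Rel n
tab n f i j = f (toℕ i) (toℕ j)

# : Rel 1
# _ _ = true

_⊔ᴿ_ : ∀ {n m} → Rel n → Rel m → Rel (n + m)
_⊔ᴿ_ {n} {m} R Q = tab (n + m) λ i j →
  ext R i j ∨ ((n ≤ᵇ i) ∧ (n ≤ᵇ j) ∧ ext Q (i ∸ n) (j ∸ n))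

data Dir : Set where
  ⊔d ↑d ↓d ↕d : Dir

up : Dir → Bool
up ↑d = true
up ↕d = true
up _  = false

down : Dir → Bool
down ↓d = true
down ↕d = true
down _  = false

-- α : [r] → Dir given as the list (α(1), …, α(r)); positions beyond r act as ⊔
Word : Set
Word = List Dir

lookupD : Word → ℕ → Dir
lookupD []      _       = ⊔d
lookupD (d ∷ _) zero    = d
lookupD (_ ∷ α) (suc k) = lookupD α k

-- the product R *_α Q (0-based: the last element of R is n ∸ 1, element
-- n+i of [n+m] (1-based) is n ∸ 1 + i, and it uses α(i) = lookupD α (i - 1))
_*[_]ᴿ_ : ∀ {n m} → Rel n → Word → Rel m → Rel (n + m)
_*[_]ᴿ_ {n} {m} R α Q = tab (n + m) λ i j →
  ext (R ⊔ᴿ Q) i j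
  ∨ ((i ≡ᵇ (n ∸ 1)) ∧ (n ≤ᵇ j) ∧ (j <ᵇ (n + m)) ∧ up   (lookupD α (j ∸ n)))
  ∨ ((j ≡ᵇ (n ∸ 1)) ∧ (n ≤ᵇ i) ∧ (i <ᵇ (n + m)) ∧ down (lookupD α (i ∸ n)))

⊔-Irreducible : ∀ {n} → Rel n → Set
⊔-Irreducible R = ∀ k m (R₁ : Rel (suc k)) (R₂ : Rel (suc m)) → ¬ (R ≅ (R₁ ⊔ᴿ R₂))

eqRel? : ∀ {n m} → Rel n → Rel m → Bool
eqRel? {n} {m} R Q with n ≟ m
... | no _     = false
... | yes refl = does (FinP.all? λ i → FinP.all? λ j → R i j BoolP.≟ Q i j)

-- α read off from the first row/column (untrimmed, length = size of R')
alpha : ∀ {m} → Rel (suc m) → Word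
alpha {m} R = map (λ k → dir (ext R 0 (suc k)) (ext R (suc k) 0)) (upTo m)
  where
  dir : Bool → Bool → Dir
  dir true  true  = ↕d
  dir true  false = ↑d
  dir false true  = ↓d
  dir false false = ⊔d

rest : ∀ {m} → Rel (suc m) → Rel m
rest R i j = R (Fin.suc i) (Fin.suc j)

-- k (1 ≤ k ≤ m) is a cut point of Q : Rel m when no pair of Q joins
-- {0,…,k-1} and {k,…,m-1} (0-based)
isCut : ∀ {m} → Rel m → ℕ → Bool
isCut {m} Q k =
  and (map (λ i → and (map (λ j → not (ext Q i j ∨ ext Q j i)) (map (k +_) (upTo (m ∸ k))))) (upTo k))

intervals : ℕ → List ℕ → List (ℕ × ℕ)
intervals a []       = []
intervals a (b ∷ bs) = (a , b ∸ a) ∷ intervals b bs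

-- the ⊔-irreducible components Q₁, …, Q_q of Q (in order), Q = Q₁ ⊔ … ⊔ Q_q
components : ∀ {m} → Rel m → List (Σ ℕ Rel)
components {m} Q =
  map (λ { (a , len) → len , tab len (λ i j → ext Q (a + i) (a + j)) })
      (intervals 0 (filter (λ k → isCut Q k BoolP.≟ true) (map suc (upTo m))))

module Lin {c ℓ} (K : Field c ℓ) where
  open Field K renaming (_+_ to _+ₖ_; _*_ to _*ₖ_; -_ to -ₖ_)

  -- finite formal linear combinations Σ a_i R_i
  Vect : Set c
  Vect = List (Carrier × Σ ℕ Rel)

  single : ∀ {n} → Rel n → Vect
  single R = (1# , _ , R) ∷ []

  embed : ∀ {n} → Carrier × Rel n → Vect
  embed (b , P) = (b , _ , P) ∷ []

  _+ᵥ_ : Vect → Vect → Vect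
  _+ᵥ_ = _++_

  _-ᵥ_ : Vect → Vect → Vect
  x -ᵥ y = x ++ map (λ { (a , R) → (-ₖ a , R) }) y

  _⊔ᵥ_ : Vect → Vect → Vect
  x ⊔ᵥ y = concatMap (λ { (a , _ , R) → map (λ { (b , _ , Q) → (a *ₖ b , _ , R ⊔ᴿ Q) }) y }) x

  _*[_]ᵥ_ : Vect → Word → Vect → Vect
  x *[ α ]ᵥ y = concatMap (λ { (a , _ , R) → map (λ { (b , _ , Q) → (a *ₖ b , _ , R *[ α ]ᴿ Q) }) y }) x

  coeff : Vect → ∀ {n} → Rel n → Carrier
  coeff x Q = foldr (λ { (a , _ , R) s → if eqRel? R Q then a +ₖ s else s }) 0# x

  _≈ᵥ_ : Vect → Vect → Set ℓ
  x ≈ᵥ y = ∀ n (Q : Rel n) → coeff x Q ≈ coeff y Q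

  ⊔-fold : List Vect → Vect
  ⊔-fold []       = []
  ⊔-fold (x ∷ []) = x
  ⊔-fold (x ∷ xs) = x ⊔ᵥ ⊔-fold xs

  init-last : List Vect → List Vect × Vect
  init-last []       = [] , []
  init-last (x ∷ []) = [] , x
  init-last (x ∷ xs) = let (i , l) = init-last xs in (x ∷ i) , l

  -- Ξ with a fuel argument (fuel = size of the relation always suffices,
  -- since components are strictly smaller); unreachable cases return 0
  Ξ′ : ℕ → ∀ n → Rel n → Vect
  Ξ′ zero    _             _ = []
  Ξ′ (suc f) zero          _ = []
  Ξ′ (suc f) (suc zero)    R = single R
  Ξ′ (suc f) (suc (suc m)) R = case (components (rest R))
    where
    α = alpha R
    rec : Σ ℕ Rel → Vect
    rec (k , C) = Ξ′ f k C
    case : List (Σ ℕ Rel) → Vect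
    case []       = []
    -- cases (1),(2): R = # *_α R' with R' ⊔-irreducible
    case (C ∷ []) = (single # *[ α ]ᵥ rec C) -ᵥ (single # ⊔ᵥ rec C)
    -- case (3): R = # *_α (R₁ ⊔ … ⊔ R_q), q > 1
    case Cs@(_ ∷ _ ∷ _) =
      let xs = map rec Cs
          (ys , z) = init-last xs
      in (single # *[ α ]ᵥ ⊔-fold xs) -ᵥ ((single # *[ α ]ᵥ ⊔-fold ys) ⊔ᵥ z)

  Ξ : ∀ {n} → Rel n → Vect
  Ξ {n} R = Ξ′ n n R

{-# OPTIONS --safe #-}

-- Call a formal combination x unitriangular for a relation T of size n when its first term is T
-- with coefficient 1 and all other terms are reflexive relations of size n strictly contained in T.
-- Along the recursion defining Ξ this is preserved by # *_α (monotone, and injective on relations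
-- of equal size) and by ⊔ (termwise). The subtracted terms of cases (2) and (3) are disjoint unions
-- A ⊔ B contained in R with 0 < |A| < |R|, so they separate at |A|, while a ⊔-irreducible R has no
-- separation point: they lie strictly below R. The components of R′ are again reflexive and
-- ⊔-irreducible, which carries the induction. Relations of different sizes are compared through
-- their extensions ext to ℕ × ℕ.

module Submission where

open import Defs
open import Level using (_⊔_)
open import Data.Bool using (Bool; true; false; _∧_; _∨_; not; if_then_else_)
open import Data.Bool.ListAction using (and)
open import Data.Bool.Properties as Bool
  using (∨-identityʳ; ∧-zeroʳ; ∨-conicalˡ; ∨-conicalʳ; ∧-conicalˡ; ∧-conicalʳ; ¬-not; not-injective; T-≡)
open import Data.Fin using (zero; suc; toℕ; fromℕ<)
open import Data.Fin.Properties using (toℕ<n; toℕ-fromℕ<; fromℕ<-toℕ; all?)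
open import Data.Nat
  using (ℕ; zero; suc; _+_; _∸_; _≤_; _<_; _<ᵇ_; _≤ᵇ_; _≡ᵇ_; z≤n; s≤s; _<?_; _≟_)
open import Data.Nat.Properties
  using ( <ᵇ⇒<; <⇒<ᵇ; ≤ᵇ⇒≤; ≤⇒≤ᵇ; ≤-refl; ≤-reflexive; ≤-trans; ≤-pred; <-trans; <-≤-trans; <⇒≤; <⇒≱; ≮⇒≥
        ; n<1+n; m<n⇒m<1+n; m≤n⇒m<n∨m≡n; +-suc; +-assoc; +-identityʳ; m≤m+n; m≤n+m; m<m+n
        ; +-monoʳ-≤; +-monoʳ-<; +-cancelˡ-≤; +-cancelˡ-<; m+[n∸m]≡n; m+n∸m≡n; m≤n+m∸n )
open import Data.List using (List; []; _∷_; _++_; map; concatMap; applyUpTo; filter)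
open import Data.List.Properties using (map-cong; map-upTo)
open import Data.List.Relation.Unary.All as All using (All; []; _∷_)
open import Data.List.Relation.Unary.All.Properties
  using (map⁺; map⁻; applyUpTo⁺₁; applyUpTo⁻; ++⁺; ++⁻ˡ; ++⁻ʳ; concat⁺)
open import Data.Product using (Σ; ∃; ∃₂; _×_; _,_; proj₁; proj₂)
open import Data.Sum using (_⊎_; inj₁; inj₂)
open import Function.Bundles using (Equivalence; mk⇔)
open import Relation.Nullary using (¬_; Dec; yes; no; contradiction)
open import Relation.Nullary.Decidable using (does-⇔)
open import Function using (_∘_; id)
open import Relation.Binary.PropositionalEquality
  using (_≡_; refl; sym; trans; cong; cong₂; subst; subst₂; module ≡-Reasoning)
open ≡-Reasoning

<⇒<ᵇ≡true : ∀ {i n} → i < n → (i <ᵇ n) ≡ true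
<⇒<ᵇ≡true i<n = Equivalence.to T-≡ (<⇒<ᵇ i<n)

<ᵇ≡true⇒< : ∀ {i n} → (i <ᵇ n) ≡ true → i < n
<ᵇ≡true⇒< {i} {n} e = <ᵇ⇒< i n (Equivalence.from T-≡ e)

≥⇒<ᵇ≡false : ∀ {i n} → n ≤ i → (i <ᵇ n) ≡ false
≥⇒<ᵇ≡false n≤i = ¬-not (λ e → <⇒≱ (<ᵇ≡true⇒< e) n≤i)

≤⇒≤ᵇ≡true : ∀ {m n} → m ≤ n → (m ≤ᵇ n) ≡ true
≤⇒≤ᵇ≡true m≤n = Equivalence.to T-≡ (≤⇒≤ᵇ m≤n)

≤ᵇ≡true⇒≤ : ∀ {m n} → (m ≤ᵇ n) ≡ true → m ≤ n
≤ᵇ≡true⇒≤ {m} {n} e = ≤ᵇ⇒≤ m n (Equivalence.from T-≡ e)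

>⇒≤ᵇ≡false : ∀ {m n} → n < m → (m ≤ᵇ n) ≡ false
>⇒≤ᵇ≡false n<m = ¬-not (λ e → <⇒≱ n<m (≤ᵇ≡true⇒≤ e))

+-cancelˡ-<ᵇ : ∀ n i m → (n + i <ᵇ n + m) ≡ (i <ᵇ m)
+-cancelˡ-<ᵇ zero    i m = refl
+-cancelˡ-<ᵇ (suc n) i m = +-cancelˡ-<ᵇ n i m

∨≡true⇒⊎ : ∀ a {b} → a ∨ b ≡ true → a ≡ true ⊎ b ≡ true
∨≡true⇒⊎ true  _ = inj₁ refl
∨≡true⇒⊎ false e = inj₂ e

data Offset (n : ℕ) : ℕ → Set where
  inside : ∀ {i} → i < n → Offset n i
  past   : ∀ k → Offset n (n + k)

offset : ∀ n i → Offset n i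
offset zero    i       = past i
offset (suc n) zero    = inside (s≤s z≤n)
offset (suc n) (suc i) with offset n i
... | inside i<n = inside (s≤s i<n)
... | past k     = past k

ℕRel : Set
ℕRel = ℕ → ℕ → Bool

infix 4 _⊆′_ _≐′_

_⊆′_ : ℕRel → ℕRel → Set
F ⊆′ G = ∀ i j → F i j ≡ true → G i j ≡ true

_≐′_ : ℕRel → ℕRel → Set
F ≐′ G = ∀ i j → F i j ≡ G i j

≐′⇒⊆′ : ∀ {F G} → F ≐′ G → F ⊆′ G
≐′⇒⊆′ F≐G i j e = trans (sym (F≐G i j)) e

⊆′-trans : ∀ {F G H} → F ⊆′ G → G ⊆′ H → F ⊆′ H
⊆′-trans F⊆G G⊆H i j e = G⊆H i j (F⊆G i j e)

⊆′-antisym : ∀ {F G} → F ⊆′ G → G ⊆′ F → F ≐′ G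
⊆′-antisym {F} {G} F⊆G G⊆F i j with F i j in eF | G i j in eG
... | true  | true  = refl
... | false | false = refl
... | true  | false = sym (trans (sym eG) (F⊆G i j eF))
... | false | true  = trans (sym eF) (G⊆F i j eG)

≐′-sym : ∀ {F G} → F ≐′ G → G ≐′ F
≐′-sym F≐G i j = sym (F≐G i j)

≐′-trans : ∀ {F G H} → F ≐′ G → G ≐′ H → F ≐′ H
≐′-trans F≐G G≐H i j = trans (F≐G i j) (G≐H i j)

ReflexiveBelow : ℕ → ℕRel → Set
ReflexiveBelow n F = ∀ i → i < n → F i i ≡ true

SeparatedAt : ℕRel → ℕ → Set
SeparatedAt F c = ∀ i j → i < c → c ≤ j → (F i j ∨ F j i) ≡ false

NoSeparationBetween : ℕRel → ℕ → ℕ → Set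
NoSeparationBetween F a b = ∀ c → a < c → c < b → ¬ SeparatedAt F c

block : ℕ → ℕ → ℕRel → ℕRel
block a k F i j = (i <ᵇ k) ∧ (j <ᵇ k) ∧ F (a + i) (a + j)

module _ {n : ℕ} (R : Rel n) where

  ext-inside : ∀ {i j} (i<n : i < n) (j<n : j < n) → ext R i j ≡ R (fromℕ< i<n) (fromℕ< j<n)
  ext-inside {i} {j} i<n j<n with i <? n | j <? n
  ... | yes _  | yes _  = refl
  ... | no i≮n | _      = contradiction i<n i≮n
  ... | yes _  | no j≮n = contradiction j<n j≮n

  ext-outsideˡ : ∀ {i j} → n ≤ i → ext R i j ≡ false
  ext-outsideˡ {i} {j} n≤i with i <? n | j <? n
  ... | yes i<n | yes _ = contradiction n≤i (<⇒≱ i<n)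
  ... | yes _   | no _  = refl
  ... | no _    | _     = refl

  ext-outsideʳ : ∀ {i j} → n ≤ j → ext R i j ≡ false
  ext-outsideʳ {i} {j} n≤j with i <? n | j <? n
  ... | yes _ | yes j<n = contradiction n≤j (<⇒≱ j<n)
  ... | yes _ | no _    = refl
  ... | no _  | _       = refl

  ext≡true⇒bounded : ∀ {i j} → ext R i j ≡ true → i < n × j < n
  ext≡true⇒bounded {i} {j} e with i <? n | j <? n
  ... | yes i<n | yes j<n = i<n , j<n

  ext-bounded : ∀ i j → ext R i j ≡ (i <ᵇ n) ∧ (j <ᵇ n) ∧ ext R i j
  ext-bounded i j with i <? n | j <? n
  ... | yes i<n | yes j<n rewrite <⇒<ᵇ≡true i<n | <⇒<ᵇ≡true j<n = refl
  ... | yes i<n | no j≮n  rewrite <⇒<ᵇ≡true i<n | ≥⇒<ᵇ≡false (≮⇒≥ j≮n) = refl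
  ... | no i≮n  | _       rewrite ≥⇒<ᵇ≡false (≮⇒≥ i≮n) = refl

  ext-toℕ : ∀ i j → ext R (toℕ i) (toℕ j) ≡ R i j
  ext-toℕ i j rewrite ext-inside (toℕ<n i) (toℕ<n j)
    | fromℕ<-toℕ i (toℕ<n i) | fromℕ<-toℕ j (toℕ<n j) = refl

ext-tab : ∀ n (F : ℕRel) i j → ext (tab n F) i j ≡ (i <ᵇ n) ∧ (j <ᵇ n) ∧ F i j
ext-tab n F i j with i <? n | j <? n
... | yes i<n | yes j<n
  rewrite <⇒<ᵇ≡true i<n | <⇒<ᵇ≡true j<n | toℕ-fromℕ< i<n | toℕ-fromℕ< j<n = refl
... | yes i<n | no j≮n  rewrite <⇒<ᵇ≡true i<n | ≥⇒<ᵇ≡false (≮⇒≥ j≮n) = refl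
... | no i≮n  | _       rewrite ≥⇒<ᵇ≡false (≮⇒≥ i≮n) = refl

module _ {n : ℕ} {P R : Rel n} where

  ≐⇒≐′ : P ≐ R → ext P ≐′ ext R
  ≐⇒≐′ P≐R i j with i <? n | j <? n
  ... | yes i<n | yes j<n = P≐R (fromℕ< i<n) (fromℕ< j<n)
  ... | yes _   | no _    = refl
  ... | no _    | _       = refl

  ≐′⇒≐ : ext P ≐′ ext R → P ≐ R
  ≐′⇒≐ P≐R i j = trans (sym (ext-toℕ P i j)) (trans (P≐R (toℕ i) (toℕ j)) (ext-toℕ R i j))

  ⊆′⇒⊆ : ext P ⊆′ ext R → P ⊆ R
  ⊆′⇒⊆ P⊆R i j e =
    trans (sym (ext-toℕ R i j)) (P⊆R (toℕ i) (toℕ j) (trans (ext-toℕ P i j) e))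

module _ {n : ℕ} {R : Rel n} where

  reflexive⇒below : Reflexive R → ReflexiveBelow n (ext R)
  reflexive⇒below refl-R i i<n = trans (ext-inside R i<n i<n) (refl-R (fromℕ< i<n))

  below⇒reflexive : ReflexiveBelow n (ext R) → Reflexive R
  below⇒reflexive refl-R i = trans (sym (ext-toℕ R i i)) (refl-R (toℕ i) (toℕ<n i))

-- Disjoint union

module _ {n m : ℕ} (A : Rel n) (B : Rel m) where

  ⊔-ext : ∀ i j → ext (A ⊔ᴿ B) i j ≡ (i <ᵇ n + m) ∧ (j <ᵇ n + m) ∧
    (ext A i j ∨ ((n ≤ᵇ i) ∧ (n ≤ᵇ j) ∧ ext B (i ∸ n) (j ∸ n)))
  ⊔-ext = ext-tab (n + m) _

  ⊔-inside : ∀ {i j} → i < n → j < n → ext (A ⊔ᴿ B) i j ≡ ext A i j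
  ⊔-inside {i} {j} i<n j<n rewrite ⊔-ext i j
    | <⇒<ᵇ≡true (<-≤-trans i<n (m≤m+n n m)) | <⇒<ᵇ≡true (<-≤-trans j<n (m≤m+n n m))
    | >⇒≤ᵇ≡false i<n = ∨-identityʳ _

  ⊔-past : ∀ i j → ext (A ⊔ᴿ B) (n + i) (n + j) ≡ ext B i j
  ⊔-past i j rewrite ⊔-ext (n + i) (n + j) | +-cancelˡ-<ᵇ n i m | +-cancelˡ-<ᵇ n j m
    | ext-outsideˡ A {n + i} {n + j} (m≤m+n n i)
    | ≤⇒≤ᵇ≡true (m≤m+n n i) | ≤⇒≤ᵇ≡true (m≤m+n n j)
    | m+n∸m≡n n i | m+n∸m≡n n j = sym (ext-bounded B i j)

  ⊔-cases : ∀ {i j} → ext (A ⊔ᴿ B) i j ≡ true →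
    ext A i j ≡ true ⊎ ∃₂ λ i′ j′ → i ≡ n + i′ × j ≡ n + j′ × ext B i′ j′ ≡ true
  ⊔-cases {i} {j} e
    with ∨≡true⇒⊎ (ext A i j)
           (∧-conicalʳ (j <ᵇ n + m) _ (∧-conicalʳ (i <ᵇ n + m) _ (trans (sym (⊔-ext i j)) e)))
  ... | inj₁ a = inj₁ a
  ... | inj₂ b = inj₂ (i ∸ n , j ∸ n , sym (m+[n∸m]≡n n≤i) , sym (m+[n∸m]≡n n≤j) , b-ext)
    where
    n≤i : n ≤ i
    n≤i = ≤ᵇ≡true⇒≤ (∧-conicalˡ (n ≤ᵇ i) _ b)
    n≤j : n ≤ j
    n≤j = ≤ᵇ≡true⇒≤ (∧-conicalˡ (n ≤ᵇ j) _ (∧-conicalʳ (n ≤ᵇ i) _ b))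
    b-ext : ext B (i ∸ n) (j ∸ n) ≡ true
    b-ext = ∧-conicalʳ (n ≤ᵇ j) _ (∧-conicalʳ (n ≤ᵇ i) _ b)

  ⊔-sides : ∀ {i j} → ext (A ⊔ᴿ B) i j ≡ true → (i < n × j < n) ⊎ (n ≤ i × n ≤ j)
  ⊔-sides e with ⊔-cases e
  ... | inj₁ a                       = inj₁ (ext≡true⇒bounded A a)
  ... | inj₂ (i′ , j′ , refl , refl , _) = inj₂ (m≤m+n n i′ , m≤m+n n j′)

  ⊔-separated : SeparatedAt (ext (A ⊔ᴿ B)) n
  ⊔-separated i j i<n n≤j = cong₂ _∨_ (¬-not (across ∘ ⊔-sides)) (¬-not (across′ ∘ ⊔-sides))
    where
    across : ¬ ((i < n × j < n) ⊎ (n ≤ i × n ≤ j))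
    across (inj₁ (_ , j<n)) = <⇒≱ j<n n≤j
    across (inj₂ (n≤i , _)) = <⇒≱ i<n n≤i
    across′ : ¬ ((j < n × i < n) ⊎ (n ≤ j × n ≤ i))
    across′ (inj₁ (j<n , _)) = <⇒≱ j<n n≤j
    across′ (inj₂ (_ , n≤i)) = <⇒≱ i<n n≤i

  ⊔-⊆ˡ : ext A ⊆′ ext (A ⊔ᴿ B)
  ⊔-⊆ˡ i j e = let i<n , j<n = ext≡true⇒bounded A e in trans (⊔-inside i<n j<n) e

  ⊔-reflexive : ReflexiveBelow n (ext A) → ReflexiveBelow m (ext B) →
    ReflexiveBelow (n + m) (ext (A ⊔ᴿ B))
  ⊔-reflexive refl-A refl-B i i<n+m with offset n i
  ... | inside i<n = trans (⊔-inside i<n i<n) (refl-A i i<n)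
  ... | past k     = trans (⊔-past k k) (refl-B k (+-cancelˡ-< n k m i<n+m))

module _ {n m : ℕ} {A A′ : Rel n} {B B′ : Rel m} where

  ⊔-mono : ext A ⊆′ ext A′ → ext B ⊆′ ext B′ → ext (A ⊔ᴿ B) ⊆′ ext (A′ ⊔ᴿ B′)
  ⊔-mono A⊆A′ B⊆B′ i j e with ⊔-cases A B e
  ... | inj₁ a = ⊔-⊆ˡ A′ B′ i j (A⊆A′ i j a)
  ... | inj₂ (i′ , j′ , refl , refl , b) = trans (⊔-past A′ B′ i′ j′) (B⊆B′ i′ j′ b)

  ⊔-injectiveˡ : ext (A ⊔ᴿ B) ≐′ ext (A′ ⊔ᴿ B′) → ext A ≐′ ext A′
  ⊔-injectiveˡ eq i j with offset n i | offset n j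
  ... | inside i<n | inside j<n =
    trans (sym (⊔-inside A B i<n j<n)) (trans (eq i j) (⊔-inside A′ B′ i<n j<n))
  ... | past k | _ = trans (ext-outsideˡ A (m≤m+n n k)) (sym (ext-outsideˡ A′ (m≤m+n n k)))
  ... | inside _ | past k = trans (ext-outsideʳ A (m≤m+n n k)) (sym (ext-outsideʳ A′ (m≤m+n n k)))

  ⊔-injectiveʳ : ext (A ⊔ᴿ B) ≐′ ext (A′ ⊔ᴿ B′) → ext B ≐′ ext B′
  ⊔-injectiveʳ eq i j =
    trans (sym (⊔-past A B i j)) (trans (eq (n + i) (n + j)) (⊔-past A′ B′ i j))

⊔-cong : ∀ {n m} {A A′ : Rel n} {B B′ : Rel m} → ext A ≐′ ext A′ → ext B ≐′ ext B′ →
  ext (A ⊔ᴿ B) ≐′ ext (A′ ⊔ᴿ B′)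
⊔-cong {A = A} {A′} {B} {B′} A≐A′ B≐B′ = ⊆′-antisym
  (⊔-mono {A = A} {A′} {B} {B′} (≐′⇒⊆′ A≐A′) (≐′⇒⊆′ B≐B′))
  (⊔-mono {A = A′} {A} {B′} {B} (≐′⇒⊆′ (≐′-sym A≐A′)) (≐′⇒⊆′ (≐′-sym B≐B′)))

-- The product # *_α P

*-ext : ∀ {n m} (P : Rel n) α (Q : Rel m) i j → ext (P *[ α ]ᴿ Q) i j ≡
  (i <ᵇ n + m) ∧ (j <ᵇ n + m) ∧
  (ext (P ⊔ᴿ Q) i j
   ∨ ((i ≡ᵇ (n ∸ 1)) ∧ (n ≤ᵇ j) ∧ (j <ᵇ (n + m)) ∧ up (lookupD α (j ∸ n)))
   ∨ ((j ≡ᵇ (n ∸ 1)) ∧ (n ≤ᵇ i) ∧ (i <ᵇ (n + m)) ∧ down (lookupD α (i ∸ n))))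
*-ext {n} {m} P α Q = ext-tab (n + m) _

⊔-⊆-* : ∀ {n m} (P : Rel n) α (Q : Rel m) → ext (P ⊔ᴿ Q) ⊆′ ext (P *[ α ]ᴿ Q)
⊔-⊆-* P α Q i j e rewrite *-ext P α Q i j | e
  | <⇒<ᵇ≡true (proj₁ (ext≡true⇒bounded (P ⊔ᴿ Q) e))
  | <⇒<ᵇ≡true (proj₂ (ext≡true⇒bounded (P ⊔ᴿ Q) e)) = refl

module _ (α : Word) {k : ℕ} (P : Rel k) where

  #*-suc-suc : ∀ i j → ext (# *[ α ]ᴿ P) (suc i) (suc j) ≡ ext P i j
  #*-suc-suc i j rewrite *-ext # α P (suc i) (suc j)
    | ∨-identityʳ (ext (# ⊔ᴿ P) (suc i) (suc j)) | ⊔-past # P i j = sym (ext-bounded P i j)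

  #*-zero-suc : ∀ j → ext (# *[ α ]ᴿ P) 0 (suc j) ≡ (j <ᵇ k) ∧ up (lookupD α j)
  #*-zero-suc j = trans (*-ext # α P 0 (suc j))
    (simplify (j <ᵇ k) _ (∨-conicalˡ (ext (# ⊔ᴿ P) 0 (suc j)) _
      (⊔-separated # P 0 (suc j) (s≤s z≤n) (s≤s z≤n))))
    where
    simplify : ∀ b {e} u → e ≡ false → b ∧ (e ∨ (b ∧ u) ∨ false) ≡ b ∧ u
    simplify true  u refl = ∨-identityʳ u
    simplify false u _    = refl

  #*-suc-zero : ∀ i → ext (# *[ α ]ᴿ P) (suc i) 0 ≡ (i <ᵇ k) ∧ down (lookupD α i)
  #*-suc-zero i = trans (*-ext # α P (suc i) 0)
    (simplify (i <ᵇ k) _ (∨-conicalʳ _ (ext (# ⊔ᴿ P) (suc i) 0)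
      (⊔-separated # P 0 (suc i) (s≤s z≤n) (s≤s z≤n))))
    where
    simplify : ∀ b {e} d → e ≡ false → b ∧ (e ∨ false ∨ (b ∧ d)) ≡ b ∧ d
    simplify true  d refl = refl
    simplify false d _    = refl

  #*-reflexive : ReflexiveBelow k (ext P) → ReflexiveBelow (suc k) (ext (# *[ α ]ᴿ P))
  #*-reflexive refl-P zero    _       = refl
  #*-reflexive refl-P (suc i) (s≤s i<k) = trans (#*-suc-suc i i) (refl-P i i<k)

<ᵇ-∧-mono : ∀ {j k k′} b → k ≤ k′ → (j <ᵇ k) ∧ b ≡ true → (j <ᵇ k′) ∧ b ≡ true
<ᵇ-∧-mono {j} {k} b k≤k′ e =
  cong₂ _∧_ (<⇒<ᵇ≡true (<-≤-trans (<ᵇ≡true⇒< (∧-conicalˡ (j <ᵇ k) b e)) k≤k′))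
            (∧-conicalʳ (j <ᵇ k) b e)

#*-mono : ∀ α {k k′} (P : Rel k) (P′ : Rel k′) → k ≤ k′ → ext P ⊆′ ext P′ →
  ext (# *[ α ]ᴿ P) ⊆′ ext (# *[ α ]ᴿ P′)
#*-mono α P P′ k≤k′ P⊆P′ zero    zero    _ = refl
#*-mono α P P′ k≤k′ P⊆P′ zero    (suc j) e =
  trans (#*-zero-suc α P′ j) (<ᵇ-∧-mono _ k≤k′ (trans (sym (#*-zero-suc α P j)) e))
#*-mono α P P′ k≤k′ P⊆P′ (suc i) zero    e =
  trans (#*-suc-zero α P′ i) (<ᵇ-∧-mono _ k≤k′ (trans (sym (#*-suc-zero α P i)) e))
#*-mono α P P′ k≤k′ P⊆P′ (suc i) (suc j) e =
  trans (#*-suc-suc α P′ i j) (P⊆P′ i j (trans (sym (#*-suc-suc α P i j)) e))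

#*-cong : ∀ α {k} {P P′ : Rel k} → ext P ≐′ ext P′ → ext (# *[ α ]ᴿ P) ≐′ ext (# *[ α ]ᴿ P′)
#*-cong α {P = P} {P′} P≐P′ = ⊆′-antisym
  (#*-mono α P P′ ≤-refl (≐′⇒⊆′ P≐P′)) (#*-mono α P′ P ≤-refl (≐′⇒⊆′ (≐′-sym P≐P′)))

#*-injective : ∀ α {k} {P P′ : Rel k} →
  ext (# *[ α ]ᴿ P) ≐′ ext (# *[ α ]ᴿ P′) → ext P ≐′ ext P′
#*-injective α {P = P} {P′} eq i j =
  trans (sym (#*-suc-suc α P i j)) (trans (eq (suc i) (suc j)) (#*-suc-suc α P′ i j))

#*-⊔-⊆ : ∀ α {a b} (A : Rel a) (B : Rel b) →
  ext ((# *[ α ]ᴿ A) ⊔ᴿ B) ⊆′ ext (# *[ α ]ᴿ (A ⊔ᴿ B))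
#*-⊔-⊆ α {a} {b} A B i j e with ⊔-cases (# *[ α ]ᴿ A) B {i} {j} e
... | inj₁ e-A = #*-mono α A (A ⊔ᴿ B) (m≤m+n a b) (⊔-⊆ˡ A B) i j e-A
... | inj₂ (i′ , j′ , refl , refl , e-B) =
  trans (#*-suc-suc α (A ⊔ᴿ B) (a + i′) (a + j′)) (trans (⊔-past A B i′ j′) e-B)

-- Separation points and components

module _ (a k : ℕ) (F : ℕRel) where

  block-inside : ∀ {i j} → i < k → j < k → block a k F i j ≡ F (a + i) (a + j)
  block-inside i<k j<k rewrite <⇒<ᵇ≡true i<k | <⇒<ᵇ≡true j<k = refl

  block-false : ∀ {i j} → F (a + i) (a + j) ≡ false → block a k F i j ≡ false
  block-false {i} {j} e rewrite e | ∧-zeroʳ (j <ᵇ k) = ∧-zeroʳ (i <ᵇ k)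

  block-reflexive : ∀ {m} → ReflexiveBelow m F → a + k ≤ m → ReflexiveBelow k (block a k F)
  block-reflexive refl-F a+k≤m i i<k =
    trans (block-inside i<k i<k) (refl-F (a + i) (<-≤-trans (+-monoʳ-< a i<k) a+k≤m))

block-full : ∀ {n} (R : Rel n) → block 0 n (ext R) ≐′ ext R
block-full R i j = sym (ext-bounded R i j)

⊔-block : ∀ {F a k l} (A : Rel k) (B : Rel l) → ext A ≐′ block a k F → ext B ≐′ block (a + k) l F →
  SeparatedAt F (a + k) → ext (A ⊔ᴿ B) ≐′ block a (k + l) F
⊔-block {F} {a} {k} {l} A B A≐ B≐ sep i j with offset k i | offset k j
... | inside i<k | inside j<k = begin
  ext (A ⊔ᴿ B) i j      ≡⟨ trans (⊔-inside A B i<k j<k) (A≐ i j) ⟩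
  block a k F i j       ≡⟨ block-inside a k F i<k j<k ⟩
  F (a + i) (a + j)     ≡⟨ block-inside a (k + l) F (widen i<k) (widen j<k) ⟨
  block a (k + l) F i j ∎
  where
  widen : ∀ {x} → x < k → x < k + l
  widen x<k = <-≤-trans x<k (m≤m+n k l)
... | past i′ | past j′
  rewrite ⊔-past A B i′ j′ | B≐ i′ j′ | +-cancelˡ-<ᵇ k i′ l | +-cancelˡ-<ᵇ k j′ l
  | +-assoc a k i′ | +-assoc a k j′ = refl
... | inside i<k | past j′ = trans (∨-conicalˡ _ _ (⊔-separated A B i (k + j′) i<k (m≤m+n k j′)))
  (sym (block-false a (k + l) F
    (∨-conicalˡ _ _ (sep (a + i) (a + (k + j′)) (+-monoʳ-< a i<k) (+-monoʳ-≤ a (m≤m+n k j′))))))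
... | past i′ | inside j<k = trans (∨-conicalʳ _ _ (⊔-separated A B j (k + i′) j<k (m≤m+n k i′)))
  (sym (block-false a (k + l) F
    (∨-conicalʳ _ _ (sep (a + j) (a + (k + i′)) (+-monoʳ-< a j<k) (+-monoʳ-≤ a (m≤m+n k i′))))))

block-separated : ∀ {F a k c} → SeparatedAt F a → SeparatedAt F (a + k) → c < k →
  SeparatedAt (block a k F) c → SeparatedAt F (a + c)
block-separated {F} {a} {k} {c} sep-a sep-a+k c<k sep-c i j i<a+c a+c≤j with offset a i | offset a j
... | inside i<a | _          = sep-a i j i<a (≤-trans (m≤m+n a c) a+c≤j)
... | past _     | inside j<a = contradiction (≤-trans (m≤m+n a c) a+c≤j) (<⇒≱ j<a)
... | past i′    | past j′ with j′ <? k
...   | no j′≮k  =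
  sep-a+k (a + i′) (a + j′) (+-monoʳ-< a (<-trans i′<c c<k)) (+-monoʳ-≤ a (≮⇒≥ j′≮k))
  where i′<c = +-cancelˡ-< a i′ c i<a+c
...   | yes j′<k =
  trans (sym (cong₂ _∨_ (block-inside a k F i′<k j′<k) (block-inside a k F j′<k i′<k)))
        (sep-c i′ j′ i′<c (+-cancelˡ-≤ a c j′ a+c≤j))
  where
  i′<c = +-cancelˡ-< a i′ c i<a+c
  i′<k = <-trans i′<c c<k

Indecomposable : ∀ {n} → Rel n → Set
Indecomposable {n} R = NoSeparationBetween (ext R) 0 n

window : ∀ {m} → Rel m → ℕ → (k : ℕ) → Rel k
window Q a k = tab k (λ i j → ext Q (a + i) (a + j))

ext-window : ∀ {m} (Q : Rel m) a k → ext (window Q a k) ≐′ block a k (ext Q)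
ext-window Q a k = ext-tab k _

and≡true⇒All : ∀ bs → and bs ≡ true → All (_≡ true) bs
and≡true⇒All []           _ = []
and≡true⇒All (true ∷ bs)  e = refl ∷ and≡true⇒All bs e
and≡true⇒All (false ∷ bs) ()

All⇒and≡true : ∀ {bs} → All (_≡ true) bs → and bs ≡ true
All⇒and≡true []          = refl
All⇒and≡true (refl ∷ ps) = All⇒and≡true ps

module _ {m : ℕ} (Q : Rel m) where

  isCut⇒separated : ∀ {k} → isCut Q k ≡ true → SeparatedAt (ext Q) k
  isCut⇒separated {k} e i j i<k k≤j with offset k j
  ... | inside j<k = contradiction k≤j (<⇒≱ j<k)
  ... | past j′ with j′ <? m ∸ k
  ...   | yes j′<m∸k = not-injective {y = false}
          (applyUpTo⁻ id (m ∸ k) (map⁻ (map⁻ (and≡true⇒All _ row))) j′<m∸k)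
    where row = applyUpTo⁻ id k (map⁻ (and≡true⇒All _ e)) i<k
  ...   | no j′≮m∸k = cong₂ _∨_ (ext-outsideʳ Q m≤k+j′) (ext-outsideˡ Q m≤k+j′)
    where m≤k+j′ = ≤-trans (m≤n+m∸n m k) (+-monoʳ-≤ k (≮⇒≥ j′≮m∸k))

  separated⇒isCut : ∀ {k} → SeparatedAt (ext Q) k → isCut Q k ≡ true
  separated⇒isCut {k} sep = All⇒and≡true (map⁺ (applyUpTo⁺₁ id k λ {i} i<k →
    All⇒and≡true (map⁺ (map⁺ (applyUpTo⁺₁ id (m ∸ k) λ {j′} _ →
      cong not (sep i (k + j′) i<k (m≤m+n k j′)))))))

  separated-at-size : SeparatedAt (ext Q) m
  separated-at-size i j _ m≤j = cong₂ _∨_ (ext-outsideʳ Q m≤j) (ext-outsideˡ Q m≤j)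

  isCut? : ∀ k → Dec (isCut Q k ≡ true)
  isCut? k = isCut Q k Bool.≟ true

  component : ℕ × ℕ → Σ ℕ Rel
  component (a , k) = k , window Q a k

  components≡ : components Q ≡ map component (intervals 0 (filter isCut? (applyUpTo suc m)))
  components≡ = trans (map-cong (λ { (a , k) → refl }) _)
    (cong (λ cands → map component (intervals 0 (filter isCut? cands))) (map-upTo suc m))

Tiling : ℕRel → ℕ → ℕ → List (Σ ℕ Rel) → Set
Tiling F a e []             = a ≡ e
Tiling F a e ((k , C) ∷ cs) = ext C ≐′ block a k F × SeparatedAt F (a + k) × Tiling F (a + k) e cs

Component : ℕ → Σ ℕ Rel → Set
Component m (k , C) = 0 < k × k ≤ m × ReflexiveBelow k (ext C) × Indecomposable C

Decomposes : ∀ {m} → Rel m → ℕ → List (Σ ℕ Rel) → Set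
Decomposes {m} Q a cs = Tiling (ext Q) a m cs × All (Component m) cs

module _ {m : ℕ} (Q : Rel m) (refl-Q : ReflexiveBelow m (ext Q)) where

  window-component : ∀ {a k} → 0 < k → a + k ≤ m → SeparatedAt (ext Q) a → SeparatedAt (ext Q) (a + k) →
    NoSeparationBetween (ext Q) a (a + k) → Component m (k , window Q a k)
  window-component {a} {k} 0<k a+k≤m sep-a sep-a+k no-sep =
    0<k , ≤-trans (m≤n+m k a) a+k≤m ,
    (λ i i<k → trans (ext-window Q a k i i) (block-reflexive a k (ext Q) refl-Q a+k≤m i i<k)) ,
    λ c 0<c c<k sep-c → no-sep (a + c) (m<m+n a 0<c) (+-monoʳ-< a c<k)
      (block-separated {ext Q} sep-a sep-a+k c<k (λ i j i<c c≤j →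
        trans (sym (cong₂ _∨_ (ext-window Q a k i j) (ext-window Q a k j i))) (sep-c i j i<c c≤j)))

  decomposes-∷ : ∀ {a s cs} → a < s → s ≤ m → SeparatedAt (ext Q) a → SeparatedAt (ext Q) s →
    NoSeparationBetween (ext Q) a s → Decomposes Q s cs →
    Decomposes Q a (component Q (a , s ∸ a) ∷ cs)
  decomposes-∷ {a} {s} a<s s≤m sep-a sep-s no-sep (tiling , comps) with offset a s
  ... | inside s<a   = contradiction (<⇒≤ s<a) (<⇒≱ a<s)
  ... | past zero    = contradiction (≤-reflexive (+-identityʳ a)) (<⇒≱ a<s)
  ... | past (suc k) rewrite m+n∸m≡n a (suc k) =
    (ext-window Q a (suc k) , sep-s , tiling) ,
    window-component (s≤s z≤n) s≤m sep-a sep-s no-sep ∷ comps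

  decomposition-end : ∀ {a s} → s ≡ suc m → a < s → NoSeparationBetween (ext Q) a s → a ≡ m
  decomposition-end refl a<s no-sep with m≤n⇒m<n∨m≡n (≤-pred a<s)
  ... | inj₁ a<m = contradiction (separated-at-size Q) (no-sep m a<m (n<1+n m))
  ... | inj₂ a≡m = a≡m

  -- f enumerates the candidate cut points s, s + 1, …, m; a is the last cut point found so far
  decomposition-from : ∀ t s a (f : ℕ → ℕ) → (∀ x → f x ≡ s + x) → s + t ≡ suc m → a < s →
    SeparatedAt (ext Q) a → NoSeparationBetween (ext Q) a s →
    Decomposes Q a (map (component Q) (intervals a (filter (isCut? Q) (applyUpTo f t))))
  decomposition-from zero s a f _ s+0≡1+m a<s _ no-sep =
    decomposition-end (trans (sym (+-identityʳ s)) s+0≡1+m) a<s no-sep , []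
  decomposition-from (suc t) s a f f≗ s+t≡1+m a<s sep-a no-sep with isCut? Q (f 0)
  ... | yes f0-cut = decomposes-∷ a<f0 f0≤m sep-a sep-f0
          (λ c a<c c<f0 → no-sep c a<c (subst (c <_) f0≡s c<f0))
          (decomposition-from t (suc s) (f 0) (f ∘ suc) (λ x → trans (f≗ (suc x)) (+-suc s x))
            (trans (sym (+-suc s t)) s+t≡1+m) (s≤s (≤-reflexive f0≡s)) sep-f0
            (λ c f0<c c<1+s → contradiction (≤-pred c<1+s) (<⇒≱ (subst (_< c) f0≡s f0<c))))
    where
    f0≡s : f 0 ≡ s
    f0≡s = trans (f≗ 0) (+-identityʳ s)
    a<f0 : a < f 0
    a<f0 = subst (a <_) (sym f0≡s) a<s
    f0≤m : f 0 ≤ m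
    f0≤m = subst (_≤ m) (sym f0≡s) (≤-pred (subst (s <_) s+t≡1+m (m<m+n s (s≤s z≤n))))
    sep-f0 : SeparatedAt (ext Q) (f 0)
    sep-f0 = isCut⇒separated Q f0-cut
  ... | no ¬f0-cut = decomposition-from t (suc s) a (f ∘ suc) (λ x → trans (f≗ (suc x)) (+-suc s x))
          (trans (sym (+-suc s t)) s+t≡1+m) (m<n⇒m<1+n a<s) sep-a no-sep′
    where
    no-sep′ : NoSeparationBetween (ext Q) a (suc s)
    no-sep′ c a<c c<1+s with m≤n⇒m<n∨m≡n (≤-pred c<1+s)
    ... | inj₁ c<s  = no-sep c a<c c<s
    ... | inj₂ refl =
      ¬f0-cut ∘ separated⇒isCut Q ∘ subst (SeparatedAt (ext Q)) (sym (trans (f≗ 0) (+-identityʳ c)))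

  components-decompose : Decomposes Q 0 (components Q)
  components-decompose = subst (Decomposes Q 0) (sym (components≡ Q))
    (decomposition-from m 1 0 suc (λ _ → refl) refl (s≤s z≤n) (λ _ _ ())
      (λ c 0<c c<1 → contradiction (≤-pred c<1) (<⇒≱ 0<c)))

⊔ᴿ-fold : Σ ℕ Rel → List (Σ ℕ Rel) → Σ ℕ Rel
⊔ᴿ-fold C       []       = C
⊔ᴿ-fold (k , C) (D ∷ Ds) = k + proj₁ (⊔ᴿ-fold D Ds) , C ⊔ᴿ proj₂ (⊔ᴿ-fold D Ds)

tiling-fold : ∀ {F a e} C Cs → Tiling F a e (C ∷ Cs) →
  a + proj₁ (⊔ᴿ-fold C Cs) ≡ e ×
  ext (proj₂ (⊔ᴿ-fold C Cs)) ≐′ block a (proj₁ (⊔ᴿ-fold C Cs)) F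
tiling-fold (k , C) []       (C≐ , _ , a+k≡e) = a+k≡e , C≐
tiling-fold {F} {a} (k , C) (D ∷ Ds) (C≐ , sep , tiling) with tiling-fold D Ds tiling
... | end≡e , U≐ =
  trans (sym (+-assoc a k _)) end≡e , ⊔-block {F} C (proj₂ (⊔ᴿ-fold D Ds)) C≐ U≐ sep

tiling-separated : ∀ {F a e} C Cs → Tiling F a e (C ∷ Cs) → SeparatedAt F e
tiling-separated (k , C) []       (_ , sep , refl) = sep
tiling-separated (k , C) (D ∷ Ds) (_ , _ , tiling) = tiling-separated D Ds tiling

tiling-++ : ∀ {F a e} xs {ys} → Tiling F a e (xs ++ ys) →
  ∃ λ b → Tiling F a b xs × Tiling F b e ys
tiling-++ []             tiling               = _ , refl , tiling
tiling-++ ((k , C) ∷ xs) (C≐ , sep , tiling) with tiling-++ xs tiling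
... | b , tiling₁ , tiling₂ = b , (C≐ , sep , tiling₁) , tiling₂

-- Reconstructing R from alpha R and rest R

lookupD-map-applyUpTo : ∀ (g : ℕ → Dir) f n {j} → j < n →
  lookupD (map g (applyUpTo f n)) j ≡ g (f j)
lookupD-map-applyUpTo g f (suc n) {zero}  _         = refl
lookupD-map-applyUpTo g f (suc n) {suc j} (s≤s j<n) = lookupD-map-applyUpTo g (f ∘ suc) n j<n

-- alpha turns the edges between 0 and k + 1 into a Dir by a function local to its definition;
-- evaluating alpha on the two-point relation with edges a : 0 → 1 and b : 1 → 0 exposes it
edgePair : Bool → Bool → Rel 2
edgePair a b zero       (suc zero) = a
edgePair a b (suc zero) zero       = b
edgePair a b _          _          = true

alpha-edgePair : ∀ a b →
  up (lookupD (alpha (edgePair a b)) 0) ≡ a × down (lookupD (alpha (edgePair a b)) 0) ≡ b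
alpha-edgePair true  true  = refl , refl
alpha-edgePair true  false = refl , refl
alpha-edgePair false true  = refl , refl
alpha-edgePair false false = refl , refl

module _ {M : ℕ} (R : Rel (suc M)) where

  alpha-edges : ∀ {j} → j < M →
    up (lookupD (alpha R) j) ≡ ext R 0 (suc j) × down (lookupD (alpha R) j) ≡ ext R (suc j) 0
  alpha-edges {j} j<M = subst (λ d → up d ≡ ext R 0 (suc j) × down d ≡ ext R (suc j) 0)
    (sym (lookupD-map-applyUpTo _ id M j<M)) (alpha-edgePair (ext R 0 (suc j)) (ext R (suc j) 0))

  ext-rest : ∀ i j → ext (rest R) i j ≡ ext R (suc i) (suc j)
  ext-rest i j with offset M i | offset M j
  ... | inside i<M | inside j<M =
    subst₂ (λ x y → ext (rest R) x y ≡ ext R (suc x) (suc y)) (toℕ-fromℕ< i<M) (toℕ-fromℕ< j<M)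
      (trans (ext-toℕ (rest R) _ _) (sym (ext-toℕ R (suc (fromℕ< i<M)) (suc (fromℕ< j<M)))))
  ... | past k | _ =
    trans (ext-outsideˡ (rest R) {j = j} (m≤m+n M k)) (sym (ext-outsideˡ R {j = suc j} (s≤s (m≤m+n M k))))
  ... | inside _ | past k =
    trans (ext-outsideʳ (rest R) {i} (m≤m+n M k)) (sym (ext-outsideʳ R {suc i} (s≤s (m≤m+n M k))))

  rest-reflexive : ReflexiveBelow (suc M) (ext R) → ReflexiveBelow M (ext (rest R))
  rest-reflexive refl-R i i<M = trans (ext-rest i i) (refl-R (suc i) (s≤s i<M))

  alpha-up : ∀ j → (j <ᵇ M) ∧ up (lookupD (alpha R) j) ≡ ext R 0 (suc j)
  alpha-up j with j <? M
  ... | yes j<M = trans (cong (_∧ up (lookupD (alpha R) j)) (<⇒<ᵇ≡true j<M)) (proj₁ (alpha-edges j<M))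
  ... | no j≮M  = trans (cong (_∧ up (lookupD (alpha R) j)) (≥⇒<ᵇ≡false (≮⇒≥ j≮M)))
                        (sym (ext-outsideʳ R {0} (s≤s (≮⇒≥ j≮M))))

  alpha-down : ∀ i → (i <ᵇ M) ∧ down (lookupD (alpha R) i) ≡ ext R (suc i) 0
  alpha-down i with i <? M
  ... | yes i<M = trans (cong (_∧ down (lookupD (alpha R) i)) (<⇒<ᵇ≡true i<M)) (proj₂ (alpha-edges i<M))
  ... | no i≮M  = trans (cong (_∧ down (lookupD (alpha R) i)) (≥⇒<ᵇ≡false (≮⇒≥ i≮M)))
                        (sym (ext-outsideˡ R {j = 0} (s≤s (≮⇒≥ i≮M))))

  #*-alpha-rest : ∀ {Q : Rel M} → ext R 0 0 ≡ true → ext Q ≐′ ext (rest R) →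
    ext (# *[ alpha R ]ᴿ Q) ≐′ ext R
  #*-alpha-rest     R00 Q≐ zero    zero    = sym R00
  #*-alpha-rest {Q} R00 Q≐ (suc i) (suc j) =
    trans (#*-suc-suc (alpha R) Q i j) (trans (Q≐ i j) (ext-rest i j))
  #*-alpha-rest {Q} R00 Q≐ zero    (suc j) = trans (#*-zero-suc (alpha R) Q j) (alpha-up j)
  #*-alpha-rest {Q} R00 Q≐ (suc i) zero    = trans (#*-suc-zero (alpha R) Q i) (alpha-down i)

separated⇒⊔-windows : ∀ {k l} (R : Rel (k + l)) → SeparatedAt (ext R) k →
  R ≐ (window R 0 k ⊔ᴿ window R k l)
separated⇒⊔-windows {k} {l} R sep = ≐′⇒≐ (≐′-trans (≐′-sym (block-full R))
  (≐′-sym (⊔-block (window R 0 k) (window R k l) (ext-window R 0 k) (ext-window R k l) sep)))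

irreducible⇒indecomposable : ∀ {n} (R : Rel n) → ⊔-Irreducible R → Indecomposable R
irreducible⇒indecomposable {n} R irr (suc k) _ c<n sep with offset (suc k) n
... | inside n<c   = contradiction (<⇒≤ n<c) (<⇒≱ c<n)
... | past zero    = contradiction (≤-reflexive (+-identityʳ (suc k))) (<⇒≱ c<n)
... | past (suc l) =
  irr k l (window R 0 (suc k)) (window R (suc k) (suc l)) (refl , separated⇒⊔-windows R sep)

-- Unitriangular vectors

data ReflexiveSub {n : ℕ} (T : Rel n) : Σ ℕ Rel → Set where
  reflexiveSub : {P : Rel n} → ReflexiveBelow n (ext P) → ext P ⊆′ ext T → ReflexiveSub T (n , P)

StrictSub : ∀ {n} → Rel n → Σ ℕ Rel → Set
StrictSub T (k , P) = ReflexiveSub T (k , P) × ¬ (ext P ≐′ ext T)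

module _ {n : ℕ} {T T′ : Rel n} where

  ReflexiveSub-resp : ext T ⊆′ ext T′ → ∀ {kP} → ReflexiveSub T kP → ReflexiveSub T′ kP
  ReflexiveSub-resp T⊆T′ (reflexiveSub refl-P P⊆T) = reflexiveSub refl-P (⊆′-trans P⊆T T⊆T′)

  StrictSub-resp : ext T ≐′ ext T′ → ∀ kP → StrictSub T kP → StrictSub T′ kP
  StrictSub-resp T≐T′ (k , P) (sub , P≉T) =
    ReflexiveSub-resp (≐′⇒⊆′ T≐T′) sub , λ P≐T′ → P≉T (≐′-trans P≐T′ (≐′-sym T≐T′))

module _ (α : Word) {n : ℕ} {T : Rel n} where

  #*-ReflexiveSub : ∀ {k} {P : Rel k} → ReflexiveSub T (k , P) →
    ReflexiveSub (# *[ α ]ᴿ T) (suc k , # *[ α ]ᴿ P)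
  #*-ReflexiveSub {P = P} (reflexiveSub refl-P P⊆T) =
    reflexiveSub (#*-reflexive α P refl-P) (#*-mono α P T ≤-refl P⊆T)

  #*-StrictSub : ∀ {k} {P : Rel k} → StrictSub T (k , P) →
    StrictSub (# *[ α ]ᴿ T) (suc k , # *[ α ]ᴿ P)
  #*-StrictSub (sub@(reflexiveSub _ _) , P≉T) = #*-ReflexiveSub sub , P≉T ∘ #*-injective α

module _ {n m : ℕ} {T : Rel n} {U : Rel m} where

  ⊔-ReflexiveSub : ∀ {k l} {P : Rel k} {Q : Rel l} → ReflexiveSub T (k , P) → ReflexiveSub U (l , Q) →
    ReflexiveSub (T ⊔ᴿ U) (k + l , P ⊔ᴿ Q)
  ⊔-ReflexiveSub {P = P} {Q} (reflexiveSub refl-P P⊆T) (reflexiveSub refl-Q Q⊆U) =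
    reflexiveSub (⊔-reflexive P Q refl-P refl-Q) (⊔-mono {A = P} {T} {Q} {U} P⊆T Q⊆U)

  ⊔-StrictSubˡ : ∀ {k l} {P : Rel k} {Q : Rel l} → StrictSub T (k , P) → ReflexiveSub U (l , Q) →
    StrictSub (T ⊔ᴿ U) (k + l , P ⊔ᴿ Q)
  ⊔-StrictSubˡ {P = P} {Q} (subP@(reflexiveSub _ _) , P≉T) subQ@(reflexiveSub _ _) =
    ⊔-ReflexiveSub subP subQ , P≉T ∘ ⊔-injectiveˡ {A = P} {T} {Q} {U}

  ⊔-StrictSubʳ : ∀ {l} {P : Rel n} {Q : Rel l} → ReflexiveBelow n (ext P) → ext P ≐′ ext T →
    StrictSub U (l , Q) → StrictSub (T ⊔ᴿ U) (n + l , P ⊔ᴿ Q)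
  ⊔-StrictSubʳ {P = P} {Q} refl-P P≐T (subQ@(reflexiveSub _ _) , Q≉U) =
    ⊔-ReflexiveSub (reflexiveSub refl-P (≐′⇒⊆′ P≐T)) subQ , Q≉U ∘ ⊔-injectiveʳ {A = P} {T} {Q} {U}

separated-StrictSub : ∀ {n a b} {R : Rel n} {A : Rel a} {B : Rel b} → a + b ≡ n → ext (A ⊔ᴿ B) ⊆′ ext R →
  Indecomposable R → 0 < a → a < n → ∀ {P Q} → ReflexiveSub A (a , P) → ReflexiveSub B (b , Q) →
  StrictSub R (a + b , P ⊔ᴿ Q)
separated-StrictSub refl A⊔B⊆R indec-R 0<a a<n {P} {Q} subP subQ =
  ReflexiveSub-resp A⊔B⊆R (⊔-ReflexiveSub subP subQ) ,
  λ P⊔Q≐R → indec-R _ 0<a a<n (λ i j i<a a≤j →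
    trans (sym (cong₂ _∨_ (P⊔Q≐R i j) (P⊔Q≐R j i))) (⊔-separated P Q i j i<a a≤j))

eqRel?-cong : ∀ {n N} {P R : Rel n} (Q : Rel N) → P ≐ R → eqRel? P Q ≡ eqRel? R Q
eqRel?-cong {n} {N} {P} {R} Q P≐R with n ≟ N
... | no _     = refl
... | yes refl = does-⇔
  (mk⇔ (λ P≐Q i j → trans (sym (P≐R i j)) (P≐Q i j)) (λ R≐Q i j → trans (P≐R i j) (R≐Q i j)))
  (all? λ i → all? λ j → P i j Bool.≟ Q i j) (all? λ i → all? λ j → R i j Bool.≟ Q i j)

splitLast : ∀ {A : Set} → A → List A → List A × A
splitLast x []       = [] , x
splitLast x (y ∷ ys) = x ∷ proj₁ (splitLast y ys) , proj₂ (splitLast y ys)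

splitLast-∷ʳ : ∀ {A : Set} (x : A) xs →
  x ∷ xs ≡ proj₁ (splitLast x xs) ++ proj₂ (splitLast x xs) ∷ []
splitLast-∷ʳ x []       = refl
splitLast-∷ʳ x (y ∷ ys) = cong (x ∷_) (splitLast-∷ʳ y ys)

module _ {c ℓ} (K : Field c ℓ) where

  open Field K using (Carrier; _≈_; 1#; _*_; *-cong; *-identityˡ; +-cong; reflexive)
    renaming (refl to ≈-refl; trans to ≈-trans)
  open Lin K

  init-last-map : ∀ {A : Set} (g : A → Vect) x xs →
    init-last (map g (x ∷ xs)) ≡ (map g (proj₁ (splitLast x xs)) , g (proj₂ (splitLast x xs)))
  init-last-map g x []       = refl
  init-last-map g x (y ∷ ys) rewrite init-last-map g y ys = refl

  if-cong : ∀ {b b′ x x′ y y′} → b ≡ b′ → x ≈ x′ → y ≈ y′ →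
    (if b then x else y) ≈ (if b′ then x′ else y′)
  if-cong {true}  refl x≈x′ _    = x≈x′
  if-cong {false} refl _    y≈y′ = y≈y′

  data Unitriangular {n : ℕ} (T : Rel n) : Vect → Set (c ⊔ ℓ) where
    leading : ∀ {a} {P : Rel n} {ts} → a ≈ 1# → ReflexiveBelow n (ext P) → ext P ≐′ ext T →
              All (StrictSub T ∘ proj₂) ts → Unitriangular T ((a , n , P) ∷ ts)

  module _ {n : ℕ} {T : Rel n} where

    Unitriangular⇒ReflexiveSub : ∀ {x} → Unitriangular T x → All (ReflexiveSub T ∘ proj₂) x
    Unitriangular⇒ReflexiveSub (leading _ refl-P P≐T strict) =
      reflexiveSub refl-P (≐′⇒⊆′ P≐T) ∷ All.map proj₁ strict

    Unitriangular-resp : ∀ {T′ : Rel n} {x} → ext T ≐′ ext T′ → Unitriangular T x → Unitriangular T′ x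
    Unitriangular-resp T≐T′ (leading a≈1 refl-P P≐T strict) = leading a≈1 refl-P (≐′-trans P≐T T≐T′)
      (All.map (λ {t} → StrictSub-resp T≐T′ (proj₂ t)) strict)

    -ᵥ-Unitriangular : ∀ {x y} → Unitriangular T x → All (StrictSub T ∘ proj₂) y →
      Unitriangular T (x -ᵥ y)
    -ᵥ-Unitriangular (leading a≈1 refl-P P≐T strict) strict-y =
      leading a≈1 refl-P P≐T (++⁺ strict (map⁺ (All.map (λ { {a , kP} s → s }) strict-y)))

  #*ᵥ-All : ∀ α {p q} {P : Σ ℕ Rel → Set p} {Q : Σ ℕ Rel → Set q} →
    (∀ {k} {A : Rel k} → P (k , A) → Q (suc k , # *[ α ]ᴿ A)) →
    ∀ {x} → All (P ∘ proj₂) x → All (Q ∘ proj₂) (single # *[ α ]ᵥ x)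
  #*ᵥ-All α f px = ++⁺ (map⁺ (All.map (λ { {b , k , A} p → f p }) px)) []

  ⊔ᵥ-All : ∀ {p q s} {P : Σ ℕ Rel → Set p} {Q : Σ ℕ Rel → Set q} {S : Σ ℕ Rel → Set s} →
    (∀ {k l} {A : Rel k} {B : Rel l} → P (k , A) → Q (l , B) → S (k + l , A ⊔ᴿ B)) →
    ∀ {x y} → All (P ∘ proj₂) x → All (Q ∘ proj₂) y → All (S ∘ proj₂) (x ⊔ᵥ y)
  ⊔ᵥ-All f px py =
    concat⁺ (map⁺ (All.map (λ { {a , k , A} p →
      map⁺ (All.map (λ { {b , l , B} q → f p q }) py) }) px))

  #*-Unitriangular : ∀ α {n} {T : Rel n} {x} → Unitriangular T x →
    Unitriangular (# *[ α ]ᴿ T) (single # *[ α ]ᵥ x)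
  #*-Unitriangular α (leading {a} {P} a≈1 refl-P P≐T strict) =
    leading (≈-trans (*-identityˡ a) a≈1) (#*-reflexive α P refl-P) (#*-cong α P≐T)
      (#*ᵥ-All α (#*-StrictSub α) strict)

  ⊔-Unitriangular : ∀ {n m} {T : Rel n} {U : Rel m} {x y} → Unitriangular T x → Unitriangular U y →
    Unitriangular (T ⊔ᴿ U) (x ⊔ᵥ y)
  ⊔-Unitriangular {T = T} {U} (leading {P = P} a≈1 refl-P P≐T strict-x)
                              u@(leading {P = Q} b≈1 refl-Q Q≐U strict-y) =
    leading (≈-trans (*-cong a≈1 b≈1) (*-identityˡ 1#)) (⊔-reflexive P Q refl-P refl-Q)
      (⊔-cong {A = P} {T} {Q} {U} P≐T Q≐U)
      (++⁺ (map⁺ (All.map (λ { {b , l , Q′} s → ⊔-StrictSubʳ refl-P P≐T s }) strict-y))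
           (⊔ᵥ-All ⊔-StrictSubˡ strict-x (Unitriangular⇒ReflexiveSub u)))

  ⊔-fold-Unitriangular : ∀ (g : Σ ℕ Rel → Vect) C Cs →
    All (λ D → Unitriangular (proj₂ D) (g D)) (C ∷ Cs) →
    Unitriangular (proj₂ (⊔ᴿ-fold C Cs)) (⊔-fold (map g (C ∷ Cs)))
  ⊔-fold-Unitriangular g (k , C) []       (u ∷ []) = u
  ⊔-fold-Unitriangular g (k , C) (D ∷ Ds) (u ∷ us) =
    ⊔-Unitriangular u (⊔-fold-Unitriangular g D Ds us)

  separated-terms-strict : ∀ {n a b} {R : Rel n} {A : Rel a} {B : Rel b} →
    a + b ≡ n → ext (A ⊔ᴿ B) ⊆′ ext R → Indecomposable R → 0 < a → a < n →
    ∀ {x y} → All (ReflexiveSub A ∘ proj₂) x → All (ReflexiveSub B ∘ proj₂) y →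
    All (StrictSub R ∘ proj₂) (x ⊔ᵥ y)
  separated-terms-strict a+b≡n A⊔B⊆R indec-R 0<a a<n = ⊔ᵥ-All λ where
    subP@(reflexiveSub _ _) subQ@(reflexiveSub _ _) →
      separated-StrictSub a+b≡n A⊔B⊆R indec-R 0<a a<n subP subQ

  module _ {m : ℕ} (R : Rel (suc (suc m))) (refl-R : ReflexiveBelow (suc (suc m)) (ext R))
           (indec-R : Indecomposable R) where

    #*-rest : ∀ {k} {F : Rel k} → k ≡ suc m → ext F ≐′ block 0 k (ext (rest R)) →
      ext (# *[ alpha R ]ᴿ F) ≐′ ext R
    #*-rest refl F≐ = #*-alpha-rest R (refl-R 0 (s≤s z≤n)) (≐′-trans F≐ (block-full (rest R)))

    #*-components-Unitriangular : ∀ (g : Σ ℕ Rel → Vect) C Cs →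
      Tiling (ext (rest R)) 0 (suc m) (C ∷ Cs) → All (λ D → Unitriangular (proj₂ D) (g D)) (C ∷ Cs) →
      Unitriangular R (single # *[ alpha R ]ᵥ ⊔-fold (map g (C ∷ Cs)))
    #*-components-Unitriangular g C Cs tiling us with tiling-fold C Cs tiling
    ... | size≡ , fold≐ =
      resize size≡ fold≐ (#*-Unitriangular (alpha R) (⊔-fold-Unitriangular g C Cs us))
      where
      resize : ∀ {k} {F : Rel k} {x} → k ≡ suc m → ext F ≐′ block 0 k (ext (rest R)) →
        Unitriangular (# *[ alpha R ]ᴿ F) x → Unitriangular R x
      resize refl F≐ = Unitriangular-resp (#*-rest refl F≐)

    case₂-Unitriangular : ∀ (g : Σ ℕ Rel → Vect) C → Tiling (ext (rest R)) 0 (suc m) (C ∷ []) →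
      Unitriangular (proj₂ C) (g C) → Unitriangular R ((single # *[ alpha R ]ᵥ g C) -ᵥ (single # ⊔ᵥ g C))
    case₂-Unitriangular g (k , C) tiling@(C≐ , _ , refl) u =
      -ᵥ-Unitriangular (#*-components-Unitriangular g (k , C) [] tiling (u ∷ []))
        (separated-terms-strict refl #⊔C⊆R indec-R (s≤s z≤n) (s≤s (s≤s z≤n))
          (reflexiveSub #-reflexive (λ _ _ e → e) ∷ []) (Unitriangular⇒ReflexiveSub u))
      where
      #-reflexive : ReflexiveBelow 1 (ext #)
      #-reflexive zero    _         = refl
      #-reflexive (suc _) (s≤s ())
      #⊔C⊆R : ext (# ⊔ᴿ C) ⊆′ ext R
      #⊔C⊆R = ⊆′-trans (⊔-⊆-* # (alpha R) C) (≐′⇒⊆′ (#*-rest refl C≐))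

    case₃-subtracted-StrictSub : ∀ (g : Σ ℕ Rel → Vect) C Cs I L → Cs ≡ I ++ L ∷ [] →
      Tiling (ext (rest R)) 0 (suc m) (C ∷ Cs) → All (Component (suc m)) (C ∷ Cs) →
      All (λ D → Unitriangular (proj₂ D) (g D)) (C ∷ Cs) →
      All (StrictSub R ∘ proj₂) ((single # *[ alpha R ]ᵥ ⊔-fold (map g (C ∷ I))) ⊔ᵥ g L)
    case₃-subtracted-StrictSub g C _ I (l , L) refl tiling comps us with tiling-++ (C ∷ I) tiling
    ... | _ , tiling-I , (L≐ , _ , k+l≡1+m) with tiling-fold C I tiling-I
    ...   | refl , F≐ = separated-terms-strict (cong suc k+l≡1+m) #*F⊔L⊆R indec-R (s≤s z≤n) (s≤s k<1+m)
            (#*ᵥ-All (alpha R) (#*-ReflexiveSub (alpha R))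
              (Unitriangular⇒ReflexiveSub (⊔-fold-Unitriangular g C I (++⁻ˡ (C ∷ I) us))))
            (Unitriangular⇒ReflexiveSub (All.head (++⁻ʳ (C ∷ I) us)))
      where
      F = proj₂ (⊔ᴿ-fold C I)
      k = proj₁ (⊔ᴿ-fold C I)
      k<1+m : k < suc m
      k<1+m = subst (k <_) k+l≡1+m (m<m+n k (proj₁ (All.head (++⁻ʳ (C ∷ I) comps))))
      #*F⊔L⊆R : ext ((# *[ alpha R ]ᴿ F) ⊔ᴿ L) ⊆′ ext R
      #*F⊔L⊆R = ⊆′-trans (#*-⊔-⊆ (alpha R) F L)
        (≐′⇒⊆′ (#*-rest k+l≡1+m (⊔-block {ext (rest R)} F L F≐ L≐ (tiling-separated C I tiling-I))))

    case₃-Unitriangular : ∀ (g : Σ ℕ Rel → Vect) C D Ds → Tiling (ext (rest R)) 0 (suc m) (C ∷ D ∷ Ds) →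
      All (Component (suc m)) (C ∷ D ∷ Ds) → All (λ E → Unitriangular (proj₂ E) (g E)) (C ∷ D ∷ Ds) →
      let xs = map g (C ∷ D ∷ Ds) in
      Unitriangular R ((single # *[ alpha R ]ᵥ ⊔-fold xs) -ᵥ
                       ((single # *[ alpha R ]ᵥ ⊔-fold (proj₁ (init-last xs))) ⊔ᵥ proj₂ (init-last xs)))
    case₃-Unitriangular g C D Ds tiling comps us =
      subst (λ p → Unitriangular R (lead -ᵥ ((single # *[ alpha R ]ᵥ ⊔-fold (proj₁ p)) ⊔ᵥ proj₂ p)))
        (sym (init-last-map g C (D ∷ Ds)))
        (-ᵥ-Unitriangular (#*-components-Unitriangular g C (D ∷ Ds) tiling us)
          (case₃-subtracted-StrictSub g C (D ∷ Ds) _ _ (splitLast-∷ʳ D Ds) tiling comps us))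
      where
      lead : Vect
      lead = single # *[ alpha R ]ᵥ ⊔-fold (map g (C ∷ D ∷ Ds))

  Ξ′-Unitriangular : ∀ f n (R : Rel n) → n ≤ f → 0 < n → ReflexiveBelow n (ext R) → Indecomposable R →
    Unitriangular R (Ξ′ f n R)
  Ξ′-Unitriangular zero    (suc n)       R () _ _ _
  Ξ′-Unitriangular (suc f) (suc zero)    R _ _ refl-R _ = leading ≈-refl refl-R (λ _ _ → refl) []
  Ξ′-Unitriangular (suc f) (suc (suc m)) R (s≤s n≤f) _ refl-R indec-R
    with components (rest R) | components-decompose (rest R) (rest-reflexive R refl-R)
  ... | []         | (() , _)
  ... | C ∷ []     | (tiling , (0<k , k≤1+m , refl-C , indec-C) ∷ []) =
    case₂-Unitriangular R refl-R indec-R (λ E → Ξ′ f (proj₁ E) (proj₂ E)) C tiling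
      (Ξ′-Unitriangular f _ _ (≤-trans k≤1+m n≤f) 0<k refl-C indec-C)
  ... | C ∷ D ∷ Ds | (tiling , comps) =
    case₃-Unitriangular R refl-R indec-R (λ E → Ξ′ f (proj₁ E) (proj₂ E)) C D Ds tiling comps
      (All.map (λ { (0<k , k≤1+m , refl-C , indec-C) →
                    Ξ′-Unitriangular f _ _ (≤-trans k≤1+m n≤f) 0<k refl-C indec-C }) comps)

  module _ {n : ℕ} {R : Rel n} where

    strictTerms : ∀ {ts} → All (StrictSub R ∘ proj₂) ts → List (Carrier × Rel n)
    strictTerms []                                                = []
    strictTerms {(a , _ , P) ∷ _} ((reflexiveSub _ _ , _) ∷ strict) = (a , P) ∷ strictTerms strict

    strictTerms-⊊ : ∀ {ts} (strict : All (StrictSub R ∘ proj₂) ts) →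
      All (λ bP → Reflexive (proj₂ bP) × (proj₂ bP ⊊ R)) (strictTerms strict)
    strictTerms-⊊ []                                          = []
    strictTerms-⊊ ((reflexiveSub refl-P P⊆R , P≉R) ∷ strict) =
      (below⇒reflexive refl-P , ⊆′⇒⊆ P⊆R , P≉R ∘ ≐⇒≐′) ∷ strictTerms-⊊ strict

    embed-strictTerms : ∀ {ts} (strict : All (StrictSub R ∘ proj₂) ts) →
      concatMap embed (strictTerms strict) ≡ ts
    embed-strictTerms []                              = refl
    embed-strictTerms ((reflexiveSub _ _ , _) ∷ strict) = cong (_ ∷_) (embed-strictTerms strict)

    Unitriangular⇒decomposition : ∀ {x} → Unitriangular R x →
      Σ (List (Carrier × Rel n)) λ bs →
        All (λ bP → Reflexive (proj₂ bP) × (proj₂ bP ⊊ R)) bs × x ≈ᵥ (single R ++ concatMap embed bs)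
    Unitriangular⇒decomposition (leading {a} {P} {ts} a≈1 _ P≐R strict) =
      strictTerms strict , strictTerms-⊊ strict , coefficients
      where
      coefficients : ((a , n , P) ∷ ts) ≈ᵥ (single R ++ concatMap embed (strictTerms strict))
      coefficients N Q = if-cong (eqRel?-cong {P = P} {R} Q (≐′⇒≐ P≐R)) (+-cong a≈1 tail≈) tail≈
        where
        tail≈ : coeff ts Q ≈ coeff (concatMap embed (strictTerms strict)) Q
        tail≈ = reflexive (cong (λ v → coeff v Q) (sym (embed-strictTerms strict)))

proposition4p20 : ∀ {c ℓ} (K : Field c ℓ) (n : ℕ) (R : Rel n) →
    1 ≤ n → Reflexive R → ⊔-Irreducible R →
    Σ (List (Field.Carrier K × Rel n)) λ bs →
      All (λ bP → Reflexive (proj₂ bP) × (proj₂ bP ⊊ R)) bs ×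
      Lin._≈ᵥ_ K (Lin.Ξ K R) (Lin.single K R ++ concatMap (Lin.embed K) bs)
proposition4p20 K n R 1≤n refl-R irreducible = Unitriangular⇒decomposition K
  (Ξ′-Unitriangular K n n R ≤-refl 1≤n (reflexive⇒below refl-R) (irreducible⇒indecomposable R irreducible))
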